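{- Let $s,t\ge 0$ and $a,b\ge 1$ be integers. The sequence $\lceil n/2\rceil$ is the unique solution of the recursion $R(n)=R(n-s-R(n-a))+R(n-t-R(n-b))$, given sufficiently many initial conditions $R(z)=\lceil z/2\rceil$ ($1\le z\le c$ for $c$ large enough), if and only if $a$ and $b$ are both odd and $2(s+t)=a+b$. -}

module Defs where

open import Data.Nat as ℕ using (ℕ; suc)
open import Data.Integer using (ℤ; +_; _+_; _-_; _≤_; _<_)
open import Data.Integer.DivMod using (_/_)
open import Data.Product using (∃-syntax; _×_)
open import Relation.Binary.PropositionalEquality using (_≡_)

Odd : ℕ → Set
Odd n = ∃[ k ] n ≡ suc (2 ℕ.* k)

-- ⌈ z / 2 ⌉ (only ever used for z ≥ 1, where it is (z+1) div 2)
ceilHalf : ℤ → ℤ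
ceilHalf z = (z + + 1) / (+ 2)

-- R is a (well-defined) solution of
--   R(n) = R(n - s - R(n - a)) + R(n - t - R(n - b))
-- with initial conditions R(z) = ⌈z/2⌉ for 1 ≤ z ≤ c:
-- every value called in the recursion for n > c lies in {1, …, n-1}.
-- Only the values of R at positive integers are relevant.
IsSolution : (s t a b : ℕ) (c : ℕ) (R : ℤ → ℤ) → Set
IsSolution s t a b c R =
  (∀ (z : ℤ) → + 1 ≤ z → z ≤ + c → R z ≡ ceilHalf z)
  × (∀ (n : ℤ) → + c < n →
       let u = n - + a
           v = n - + b
           p = n - + s - R u
           q = n - + t - R v
       in (+ 1 ≤ u) × (+ 1 ≤ v) × (+ 1 ≤ p) × (p < n) × (+ 1 ≤ q) × (q < n)
          × (R n ≡ R p + R q))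

CeilIsUniqueSolution : (s t a b c : ℕ) → Set
CeilIsUniqueSolution s t a b c =
  IsSolution s t a b c ceilHalf
  × (∀ R → IsSolution s t a b c R → ∀ (n : ℤ) → + 1 ≤ n → R n ≡ ceilHalf n)

module Submission where

-- Substituting R = ⌈·/2⌉ collapses each
-- nested term to one quarter, ⌈(n − s − ⌈(n−a)/2⌉)/2⌉ = ⌊(n + α)/4⌋ with the
-- offset α = a − 2s + 2, whereas ⌈n/2⌉ = ⌊(n+1)/4⌋ + ⌊(n+3)/4⌋.  Hence ⌈·/2⌉
-- solves the recursion for large n iff ⌊(n+α)/4⌋ + ⌊(n+β)/4⌋ (β = b − 2t + 2)
-- equals ⌊(n+1)/4⌋ + ⌊(n+3)/4⌋ for large n.  Summing over four consecutive n
-- forces α + β = 4; then only ρ = α mod 4 matters, the identity holds for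
-- ρ ∈ {1, 3} and fails at explicit points for ρ ∈ {0, 2}.  Finally α is odd iff
-- a is, and α + β = 4 iff 2(s + t) = a + b.  Uniqueness is strong induction,
-- and for ⌈·/2⌉ all called arguments are admissible beyond a + 2s + 3.

open import Defs
open import Data.Nat as ℕ using (ℕ; zero; suc; z≤n; s≤s)
import Data.Nat.Properties as ℕP
import Data.Nat.DivMod as ℕD
open import Data.Integer as ℤ using (ℤ; +_; -[1+_]; _+_; _-_; _*_; -_; _≤_; _<_; +≤+; +<+; 0ℤ; ∣_∣)
open import Data.Integer.DivMod using (_/_; _%_; a≡a%n+[a/n]*n; n%d<d)
import Data.Integer.Properties as ℤP
open import Data.Integer.Tactic.RingSolver using (solve-∀)
open import Data.Empty using (⊥-elim)
open import Data.Nat.Induction using (<-rec)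
open import Relation.Nullary using (yes; no)
open import Data.Product using (∃-syntax; _×_; _,_)
open import Function.Bundles using (_⇔_; mk⇔; Equivalence)
open import Data.Sum using (_⊎_; inj₁; inj₂)
open import Relation.Binary.PropositionalEquality

remainder-difference≡0 : ∀ {d r r′} (e : ℤ) → e * + d ≡ + r′ - + r →
                         r ℕ.< d → r′ ℕ.< d → e ≡ 0ℤ
remainder-difference≡0 {d} {r} {r′} e eq r<d r′<d = ℤP.∣i∣≡0⇒i≡0 (m*n<n⇒m≡0 ∣ e ∣ d ∣e∣*d<d)
  where
  open ℕP.≤-Reasoning
  ∣e∣*d<d : ∣ e ∣ ℕ.* d ℕ.< d
  ∣e∣*d<d = begin-strict
    ∣ e ∣ ℕ.* d      ≡⟨ ℤP.abs-* e (+ d) ⟨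
    ∣ e * + d ∣      ≡⟨ cong ∣_∣ (trans eq (ℤP.m-n≡m⊖n r′ r)) ⟩
    ∣ r′ ℤ.⊖ r ∣     ≤⟨ ℤP.∣m⊝n∣≤m⊔n r′ r ⟩
    r′ ℕ.⊔ r         <⟨ ℕP.⊔-pres-<m r′<d r<d ⟩
    d                ∎
  m*n<n⇒m≡0 : ∀ m n → m ℕ.* n ℕ.< n → m ≡ 0
  m*n<n⇒m≡0 zero    _ _ = refl
  m*n<n⇒m≡0 (suc m) n h = ⊥-elim (ℕP.m+n≮m n (m ℕ.* n) h)

div-unique : ∀ d .{{_ : ℕ.NonZero d}} (x q : ℤ) (r : ℕ) →
             x ≡ + r + q * + d → r ℕ.< d → x / + d ≡ q
div-unique d x q r x≡r+qd r<d =
  ℤP.i-j≡0⇒i≡j q₀ q (remainder-difference≡0 (q₀ - q) difference (n%d<d x (+ d)) r<d)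
  where
  r₀ : ℕ
  r₀ = x % + d
  q₀ : ℤ
  q₀ = x / + d
  open ≡-Reasoning
  expand : ∀ (r₀ q₀ q d : ℤ) → (q₀ - q) * d ≡ (r₀ + q₀ * d) - q * d - r₀
  expand = solve-∀
  collapse : ∀ (r q d r₀ : ℤ) → (r + q * d) - q * d - r₀ ≡ r - r₀
  collapse = solve-∀
  difference : (q₀ - q) * + d ≡ + r - + r₀
  difference = begin
    (q₀ - q) * + d                      ≡⟨ expand (+ r₀) q₀ q (+ d) ⟩
    (+ r₀ + q₀ * + d) - q * + d - + r₀  ≡⟨ cong (λ y → y - q * + d - + r₀) (trans (sym (a≡a%n+[a/n]*n x (+ d))) x≡r+qd) ⟩
    (+ r + q * + d) - q * + d - + r₀    ≡⟨ collapse (+ r) q (+ d) (+ r₀) ⟩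
    + r - + r₀                          ∎

div-shift : ∀ d .{{_ : ℕ.NonZero d}} (x m : ℤ) → (x + m * + d) / + d ≡ x / + d + m
div-shift d x m = div-unique d (x + m * + d) (x / + d + m) (x % + d) regroup (n%d<d x (+ d))
  where
  regroup′ : ∀ (r q m d : ℤ) → (r + q * d) + m * d ≡ r + (q + m) * d
  regroup′ = solve-∀
  regroup : x + m * + d ≡ + (x % + d) + (x / + d + m) * + d
  regroup = trans (cong (_+ m * + d) (a≡a%n+[a/n]*n x (+ d))) (regroup′ (+ (x % + d)) (x / + d) m (+ d))

instance
  nonZero-* : ∀ {m n} .{{_ : ℕ.NonZero m}} .{{_ : ℕ.NonZero n}} → ℕ.NonZero (m ℕ.* n)
  nonZero-* {m} {n} = ℕP.m*n≢0 m n

div-div : ∀ d e .{{_ : ℕ.NonZero d}} .{{_ : ℕ.NonZero e}} (x : ℤ) →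
          (x / + d) / + e ≡ x / + (d ℕ.* e)
div-div d e x = sym (div-unique (d ℕ.* e) x q₂ (r₁ ℕ.+ r₂ ℕ.* d) decomposition bound)
  where
  r₁ r₂ : ℕ
  q₁ q₂ : ℤ
  r₁ = x % + d
  q₁ = x / + d
  r₂ = q₁ % + e
  q₂ = q₁ / + e
  open ≡-Reasoning
  reassociate : ∀ (r₁ r₂ q₂ d e : ℤ) → r₁ + (r₂ + q₂ * e) * d ≡ (r₁ + r₂ * d) + q₂ * (d * e)
  reassociate = solve-∀
  decomposition : x ≡ + (r₁ ℕ.+ r₂ ℕ.* d) + q₂ * + (d ℕ.* e)
  decomposition = begin
    x                                        ≡⟨ a≡a%n+[a/n]*n x (+ d) ⟩
    + r₁ + q₁ * + d                          ≡⟨ cong (λ y → + r₁ + y * + d) (a≡a%n+[a/n]*n q₁ (+ e)) ⟩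
    + r₁ + (+ r₂ + q₂ * + e) * + d           ≡⟨ reassociate (+ r₁) (+ r₂) q₂ (+ d) (+ e) ⟩
    (+ r₁ + + r₂ * + d) + q₂ * (+ d * + e)   ≡⟨ cong₂ (λ y z → y + q₂ * z)
                                                  (trans (cong (λ y → + r₁ + y) (sym (ℤP.pos-* r₂ d))) (sym (ℤP.pos-+ r₁ (r₂ ℕ.* d))))
                                                  (sym (ℤP.pos-* d e)) ⟩
    + (r₁ ℕ.+ r₂ ℕ.* d) + q₂ * + (d ℕ.* e)   ∎
  bound : r₁ ℕ.+ r₂ ℕ.* d ℕ.< d ℕ.* e
  bound = ℕP.<-≤-trans (ℕP.+-monoˡ-< (r₂ ℕ.* d) (n%d<d x (+ d)))
            (subst (suc r₂ ℕ.* d ℕ.≤_) (ℕP.*-comm e d) (ℕP.*-monoˡ-≤ d (n%d<d q₁ (+ e))))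

half : ℤ → ℤ
half x = x / + 2

quarter : ℤ → ℤ
quarter x = x / + 4

half-pair : ∀ z → half z + half (z + + 1) ≡ z
half-pair z with z % + 2 | n%d<d z (+ 2) | a≡a%n+[a/n]*n z (+ 2)
... | 0 | _ | z≡ = begin
  half z + half (z + + 1)  ≡⟨ cong (λ w → half z + w) (div-unique 2 (z + + 1) (half z) 1 (trans (cong (_+ + 1) z≡) (odd (half z))) (s≤s (s≤s z≤n))) ⟩
  half z + half z          ≡⟨ double (half z) ⟩
  + 0 + half z * + 2       ≡⟨ z≡ ⟨
  z                        ∎
  where
  open ≡-Reasoning
  odd : ∀ q → + 0 + q * + 2 + + 1 ≡ + 1 + q * + 2
  odd = solve-∀
  double : ∀ q → q + q ≡ + 0 + q * + 2
  double = solve-∀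
... | 1 | _ | z≡ = begin
  half z + half (z + + 1)      ≡⟨ cong (λ w → half z + w) (div-unique 2 (z + + 1) (half z + + 1) 0 (trans (cong (_+ + 1) z≡) (carry (half z))) (s≤s z≤n)) ⟩
  half z + (half z + + 1)      ≡⟨ double (half z) ⟩
  + 1 + half z * + 2           ≡⟨ z≡ ⟨
  z                            ∎
  where
  open ≡-Reasoning
  carry : ∀ q → + 1 + q * + 2 + + 1 ≡ + 0 + (q + + 1) * + 2
  carry = solve-∀
  double : ∀ q → q + (q + + 1) ≡ + 1 + q * + 2
  double = solve-∀
... | suc (suc _) | s≤s (s≤s ()) | _

half-half : ∀ y → half (half y) ≡ quarter y
half-half = div-div 2 2

-- ⌊y/2⌋ = ⌊y/4⌋ + ⌊(y+2)/4⌋: apply half-pair to ⌊y/2⌋.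
half-quarters : ∀ y → half y ≡ quarter y + quarter (y + + 2)
half-quarters y = begin
  half y                                  ≡⟨ half-pair (half y) ⟨
  half (half y) + half (half y + + 1)     ≡⟨ cong (λ w → half (half y) + half w) (div-shift 2 y (+ 1)) ⟨
  half (half y) + half (half (y + + 2))   ≡⟨ cong₂ _+_ (half-half y) (half-half (y + + 2)) ⟩
  quarter y + quarter (y + + 2)           ∎
  where open ≡-Reasoning

ceilHalf-quarters : ∀ n → ceilHalf n ≡ quarter (n + + 1) + quarter (n + + 3)
ceilHalf-quarters n =
  trans (half-quarters (n + + 1)) (cong (λ w → quarter (n + + 1) + quarter w) (ℤP.+-assoc n (+ 1) (+ 2)))

quarter-window : ∀ y → quarter y + quarter (y + + 1) + quarter (y + + 2) + quarter (y + + 3) ≡ y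
quarter-window y = begin
  quarter y + quarter (y + + 1) + quarter (y + + 2) + quarter (y + + 3)   ≡⟨ interleave (quarter y) _ _ _ ⟩
  (quarter y + quarter (y + + 2)) + (quarter (y + + 1) + quarter (y + + 3)) ≡⟨ cong₂ _+_ (half-quarters y) (ceilHalf-quarters y) ⟨
  half y + half (y + + 1)                                                  ≡⟨ half-pair y ⟩
  y                                                                        ∎
  where
  open ≡-Reasoning
  interleave : ∀ (a b c d : ℤ) → a + b + c + d ≡ (a + c) + (b + d)
  interleave = solve-∀

offset : ℕ → ℕ → ℤ
offset a s = + a - + s - + s + + 2

ceilHalf-nested : ∀ n a s → ceilHalf (n - + s - ceilHalf (n - + a)) ≡ quarter (n + offset a s)
ceilHalf-nested n a s = begin
  half (n - + s - half z + + 1)                 ≡⟨ cong half (regroup n (+ a) (+ s) (half z)) ⟩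
  half ((z - half z) + (+ a - + s))             ≡⟨ cong (λ w → half (w + (+ a - + s))) complement ⟩
  half (half (z + + 1) + (+ a - + s))           ≡⟨ cong half (div-shift 2 (z + + 1) (+ a - + s)) ⟨
  half (half (z + + 1 + (+ a - + s) * + 2))     ≡⟨ half-half (z + + 1 + (+ a - + s) * + 2) ⟩
  quarter (z + + 1 + (+ a - + s) * + 2)         ≡⟨ cong quarter (collect n (+ a) (+ s)) ⟩
  quarter (n + offset a s)                      ∎
  where
  open ≡-Reasoning
  z : ℤ
  z = n - + a + + 1
  regroup : ∀ (n a s h : ℤ) → n - s - h + + 1 ≡ ((n - a + + 1) - h) + (a - s)
  regroup = solve-∀
  collect : ∀ (n a s : ℤ) → n - a + + 1 + + 1 + (a - s) * + 2 ≡ n + (a - s - s + + 2)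
  collect = solve-∀
  complement : z - half z ≡ half (z + + 1)
  complement = begin
    z - half z                               ≡⟨ cong (_- half z) (half-pair z) ⟨
    half z + half (z + + 1) - half z         ≡⟨ cancel (half z) (half (z + + 1)) ⟩
    half (z + + 1)                           ∎
    where
    cancel : ∀ (h h′ : ℤ) → h + h′ - h ≡ h′
    cancel = solve-∀

quarterPair : ℤ → ℤ → ℤ → ℤ
quarterPair α β n = quarter (n + α) + quarter (n + β)

ceilHalf-recursion : ∀ n s t a b →
  ceilHalf (n - + s - ceilHalf (n - + a)) + ceilHalf (n - + t - ceilHalf (n - + b))
    ≡ quarterPair (offset a s) (offset b t) n
ceilHalf-recursion n s t a b = cong₂ _+_ (ceilHalf-nested n a s) (ceilHalf-nested n b t)

window : (ℤ → ℤ) → ℤ → ℤ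
window f y = f y + f (y + + 1) + f (y + + 2) + f (y + + 3)

window-cong : ∀ {f g} y → (∀ n → y ≤ n → f n ≡ g n) → window f y ≡ window g y
window-cong {f} {g} y f≗g =
  cong₂ _+_ (cong₂ _+_ (cong₂ _+_ (f≗g y ℤP.≤-refl) (at 1)) (at 2)) (at 3)
  where
  at : ∀ j → f (y + + j) ≡ g (y + + j)
  at j = f≗g (y + + j) (ℤP.i≤i+j y (+ j))

window-+ : ∀ f g y → window (λ n → f n + g n) y ≡ window f y + window g y
window-+ f g y = interleave (f y) (g y) (f (y + + 1)) (g (y + + 1)) (f (y + + 2)) (g (y + + 2)) (f (y + + 3)) (g (y + + 3))
  where
  interleave : ∀ (a₀ b₀ a₁ b₁ a₂ b₂ a₃ b₃ : ℤ) →
    (a₀ + b₀) + (a₁ + b₁) + (a₂ + b₂) + (a₃ + b₃) ≡ (a₀ + a₁ + a₂ + a₃) + (b₀ + b₁ + b₂ + b₃)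
  interleave = solve-∀

window-translate : ∀ f α y → window (λ n → f (n + α)) y ≡ window f (y + α)
window-translate f α y =
  cong₂ _+_ (cong₂ _+_ (cong (λ w → f (y + α) + f w) (swap 1)) (cong f (swap 2))) (cong f (swap 3))
  where
  swap : ∀ j → y + + j + α ≡ y + α + + j
  swap j = trans (ℤP.+-assoc y (+ j) α) (trans (cong (λ w → y + w) (ℤP.+-comm (+ j) α)) (sym (ℤP.+-assoc y α (+ j))))

-- The window of ⌈·/2⌉ at y: pair up ⌈y/2⌉ + ⌈(y+1)/2⌉ = y + 1 and likewise at y + 2.
window-ceilHalf : ∀ y → window ceilHalf y ≡ (y + + 1) + (y + + 3)
window-ceilHalf y = begin
  window ceilHalf y                                                     ≡⟨ ℤP.+-assoc (half (y + + 1) + half (y + + 1 + + 1)) _ _ ⟩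
  (half (y + + 1) + half (y + + 1 + + 1)) + (half (y + + 2 + + 1) + half (y + + 3 + + 1)) ≡⟨ cong₂ _+_ (half-pair (y + + 1)) upper ⟩
  (y + + 1) + (y + + 3)                                                 ∎
  where
  open ≡-Reasoning
  upper : half (y + + 2 + + 1) + half (y + + 3 + + 1) ≡ y + + 3
  upper = trans (cong (λ w → half (y + + 2 + + 1) + half (w + + 1)) (sym y+2+1≡y+3))
                (trans (half-pair (y + + 2 + + 1)) y+2+1≡y+3)
    where
    y+2+1≡y+3 : y + + 2 + + 1 ≡ y + + 3
    y+2+1≡y+3 = ℤP.+-assoc y (+ 2) (+ 1)

window-quarterPair : ∀ α β y → window (quarterPair α β) y ≡ (y + α) + (y + β)
window-quarterPair α β y = begin
  window (quarterPair α β) y                                              ≡⟨ window-+ (λ n → quarter (n + α)) (λ n → quarter (n + β)) y ⟩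
  window (λ n → quarter (n + α)) y + window (λ n → quarter (n + β)) y     ≡⟨ cong₂ _+_ (translated α) (translated β) ⟩
  (y + α) + (y + β)                                                       ∎
  where
  open ≡-Reasoning
  translated : ∀ γ → window (λ n → quarter (n + γ)) y ≡ y + γ
  translated γ = trans (window-translate quarter γ y) (quarter-window (y + γ))

-- If ⌈·/2⌉ agrees with quarterPair α β from y onwards, then α + β = 4:
-- compare the windows at y.
offsets-sum : ∀ α β y → (∀ n → y ≤ n → ceilHalf n ≡ quarterPair α β n) → α + β ≡ + 4
offsets-sum α β y agree = begin
  α + β                                ≡⟨ isolate y α β ⟩
  ((y + α) + (y + β)) - (y + y)        ≡⟨ cong (_- (y + y)) windows ⟨
  ((y + + 1) + (y + + 3)) - (y + y)    ≡⟨ constant y ⟩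
  + 4                                  ∎
  where
  open ≡-Reasoning
  isolate : ∀ (y α β : ℤ) → α + β ≡ ((y + α) + (y + β)) - (y + y)
  isolate = solve-∀
  constant : ∀ (y : ℤ) → ((y + + 1) + (y + + 3)) - (y + y) ≡ + 4
  constant = solve-∀
  windows : (y + + 1) + (y + + 3) ≡ (y + α) + (y + β)
  windows = trans (sym (window-ceilHalf y)) (trans (window-cong y agree) (window-quarterPair α β y))

quarterPair-residue : ∀ α β n → α + β ≡ + 4 →
  quarterPair α β n ≡ quarterPair (+ (α % + 4)) (+ 4 - + (α % + 4)) n
quarterPair-residue α β n α+β≡4 = begin
  quarter (n + α) + quarter (n + β)
    ≡⟨ cong₂ (λ u v → quarter u + quarter v) (trans (cong (λ w → n + w) α≡) (shiftα n ρ g))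
                                              (trans (cong (λ w → n + w) β≡) (shiftβ n ρ g)) ⟩
  quarter (n + ρ + g * + 4) + quarter (n + (+ 4 - ρ) + - g * + 4)
    ≡⟨ cong₂ _+_ (div-shift 4 (n + ρ) g) (div-shift 4 (n + (+ 4 - ρ)) (- g)) ⟩
  (quarter (n + ρ) + g) + (quarter (n + (+ 4 - ρ)) + - g)
    ≡⟨ cancel (quarter (n + ρ)) (quarter (n + (+ 4 - ρ))) g ⟩
  quarter (n + ρ) + quarter (n + (+ 4 - ρ))
    ∎
  where
  open ≡-Reasoning
  ρ g : ℤ
  ρ = + (α % + 4)
  g = α / + 4
  α≡ : α ≡ ρ + g * + 4
  α≡ = a≡a%n+[a/n]*n α (+ 4)
  β≡ : β ≡ (+ 4 - ρ) + - g * + 4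
  β≡ = begin
    β                      ≡⟨ isolate α β ⟩
    (α + β) - α            ≡⟨ cong₂ _-_ α+β≡4 α≡ ⟩
    + 4 - (ρ + g * + 4)    ≡⟨ negate ρ g ⟩
    (+ 4 - ρ) + - g * + 4  ∎
    where
    isolate : ∀ (α β : ℤ) → β ≡ (α + β) - α
    isolate = solve-∀
    negate : ∀ (ρ g : ℤ) → + 4 - (ρ + g * + 4) ≡ (+ 4 - ρ) + - g * + 4
    negate = solve-∀
  shiftα : ∀ (n ρ g : ℤ) → n + (ρ + g * + 4) ≡ n + ρ + g * + 4
  shiftα = solve-∀
  shiftβ : ∀ (n ρ g : ℤ) → n + ((+ 4 - ρ) + - g * + 4) ≡ n + (+ 4 - ρ) + - g * + 4
  shiftβ = solve-∀
  cancel : ∀ (u v g : ℤ) → (u + g) + (v + - g) ≡ u + v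
  cancel = solve-∀

quarter-at : ∀ x j → j ℕ.< 4 → quarter (x * + 4 + + j) ≡ x
quarter-at x j j<4 = div-unique 4 (x * + 4 + + j) x j (ℤP.+-comm (x * + 4) (+ j)) j<4

next-multiple : ∀ x → x * + 4 + + 4 ≡ (x + + 1) * + 4 + + 0
next-multiple = solve-∀

consecutive-sum : ∀ x → x + (x + + 1) ≡ + 1 + (x + x)
consecutive-sum = solve-∀

residue0-mismatch : ∀ x → quarterPair (+ 1) (+ 3) (x * + 4) ≢ quarterPair (+ 0) (+ 4) (x * + 4)
residue0-mismatch x eq = ℤP.i≢suc[i] (trans (sym odd) (trans eq even))
  where
  odd : quarterPair (+ 1) (+ 3) (x * + 4) ≡ x + x
  odd = cong₂ _+_ (quarter-at x 1 (s≤s (s≤s z≤n))) (quarter-at x 3 (s≤s (s≤s (s≤s (s≤s z≤n)))))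
  even : quarterPair (+ 0) (+ 4) (x * + 4) ≡ + 1 + (x + x)
  even = trans (cong₂ _+_ (quarter-at x 0 (s≤s z≤n))
                          (trans (cong quarter (next-multiple x)) (quarter-at (x + + 1) 0 (s≤s z≤n))))
               (consecutive-sum x)

residue2-mismatch : ∀ x → quarterPair (+ 1) (+ 3) (x * + 4 + + 1) ≢ quarterPair (+ 2) (+ 2) (x * + 4 + + 1)
residue2-mismatch x eq = ℤP.i≢suc[i] (trans (sym even) (trans (sym eq) odd))
  where
  n≡ : ∀ j → x * + 4 + + 1 + + j ≡ x * + 4 + + (1 ℕ.+ j)
  n≡ j = ℤP.+-assoc (x * + 4) (+ 1) (+ j)
  odd : quarterPair (+ 1) (+ 3) (x * + 4 + + 1) ≡ + 1 + (x + x)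
  odd = trans (cong₂ _+_ (trans (cong quarter (n≡ 1)) (quarter-at x 2 (s≤s (s≤s (s≤s z≤n)))))
                         (trans (cong quarter (trans (n≡ 3) (next-multiple x))) (quarter-at (x + + 1) 0 (s≤s z≤n))))
              (consecutive-sum x)
  even : quarterPair (+ 2) (+ 2) (x * + 4 + + 1) ≡ x + x
  even = cong₂ _+_ three three
    where
    three : quarter (x * + 4 + + 1 + + 2) ≡ x
    three = trans (cong quarter (n≡ 2)) (quarter-at x 3 (s≤s (s≤s (s≤s (s≤s z≤n)))))

quarterPair-odd-residue : ∀ ρ n → ρ ≡ 1 ⊎ ρ ≡ 3 → quarterPair (+ 1) (+ 3) n ≡ quarterPair (+ ρ) (+ 4 - + ρ) n
quarterPair-odd-residue _ _ (inj₁ refl) = refl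
quarterPair-odd-residue _ n (inj₂ refl) = ℤP.+-comm (quarter (n + + 1)) (quarter (n + + 3))

beyond : ∀ c → + c < + suc c * + 4
beyond c = +<+ (ℕP.m≤m*n (suc c) 4)

odd-residue : ∀ c ρ → ρ ℕ.< 4 →
  (∀ n → + c < n → quarterPair (+ 1) (+ 3) n ≡ quarterPair (+ ρ) (+ 4 - + ρ) n) → ρ ≡ 1 ⊎ ρ ≡ 3
odd-residue c 0 _ agree = ⊥-elim (residue0-mismatch (+ suc c) (agree _ (beyond c)))
odd-residue c 1 _ _ = inj₁ refl
odd-residue c 2 _ agree =
  ⊥-elim (residue2-mismatch (+ suc c) (agree _ (ℤP.<-≤-trans (beyond c) (ℤP.i≤i+j _ (+ 1)))))
odd-residue c 3 _ _ = inj₂ refl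
odd-residue c (suc (suc (suc (suc _)))) (s≤s (s≤s (s≤s (s≤s ())))) _

Oddℤ : ℤ → Set
Oddℤ x = ∃[ y ] x ≡ + 1 + y * + 2

odd≢even : ∀ x y → + 1 + x * + 2 ≢ y * + 2
odd≢even x y eq = ℤP.i≢suc[i] (trans (cong (_* + 2) (sym y≡x)) (sym eq))
  where
  open ≡-Reasoning
  difference : (y - x) * + 2 ≡ + 1 - + 0
  difference = begin
    (y - x) * + 2              ≡⟨ expand x y ⟩
    y * + 2 - x * + 2          ≡⟨ cong (_- x * + 2) eq ⟨
    + 1 + x * + 2 - x * + 2    ≡⟨ collapse x ⟩
    + 1 - + 0                  ∎
    where
    expand : ∀ (x y : ℤ) → (y - x) * + 2 ≡ y * + 2 - x * + 2
    expand = solve-∀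
    collapse : ∀ (x : ℤ) → + 1 + x * + 2 - x * + 2 ≡ + 1 - + 0
    collapse = solve-∀
  y≡x : y ≡ x
  y≡x = ℤP.i-j≡0⇒i≡j y x (remainder-difference≡0 (y - x) difference (s≤s z≤n) (s≤s (s≤s z≤n)))

residue⇒oddℤ : ∀ α → α % + 4 ≡ 1 ⊎ α % + 4 ≡ 3 → Oddℤ α
residue⇒oddℤ α (inj₁ ρ≡1) = α / + 4 * + 2 ,
  trans (a≡a%n+[a/n]*n α (+ 4)) (trans (cong (λ r → + r + α / + 4 * + 4) ρ≡1) (regroup (α / + 4)))
  where
  regroup : ∀ g → + 1 + g * + 4 ≡ + 1 + g * + 2 * + 2
  regroup = solve-∀
residue⇒oddℤ α (inj₂ ρ≡3) = α / + 4 * + 2 + + 1 ,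
  trans (a≡a%n+[a/n]*n α (+ 4)) (trans (cong (λ r → + r + α / + 4 * + 4) ρ≡3) (regroup (α / + 4)))
  where
  regroup : ∀ g → + 3 + g * + 4 ≡ + 1 + (g * + 2 + + 1) * + 2
  regroup = solve-∀

oddℤ⇒residue : ∀ α → Oddℤ α → α % + 4 ≡ 1 ⊎ α % + 4 ≡ 3
oddℤ⇒residue α (y , α≡odd) with α % + 4 | n%d<d α (+ 4) | a≡a%n+[a/n]*n α (+ 4)
... | 0 | _ | α≡ = ⊥-elim (odd≢even y (α / + 4 * + 2) (trans (sym α≡odd) (trans α≡ (regroup (α / + 4)))))
  where
  regroup : ∀ g → + 0 + g * + 4 ≡ g * + 2 * + 2
  regroup = solve-∀
... | 1 | _ | _ = inj₁ refl
... | 2 | _ | α≡ = ⊥-elim (odd≢even y (α / + 4 * + 2 + + 1) (trans (sym α≡odd) (trans α≡ (regroup (α / + 4)))))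
  where
  regroup : ∀ g → + 2 + g * + 4 ≡ (g * + 2 + + 1) * + 2
  regroup = solve-∀
... | 3 | _ | _ = inj₂ refl
... | suc (suc (suc (suc _))) | s≤s (s≤s (s≤s (s≤s ()))) | _

odd⇒oddOffset : ∀ a s → Odd a → Oddℤ (offset a s)
odd⇒oddOffset a s (k , a≡) = + k - + s + + 1 , (begin
  + a - + s - + s + + 2                     ≡⟨ cong (λ n → + n - + s - + s + + 2) a≡ ⟩
  + 1 + + (2 ℕ.* k) - + s - + s + + 2       ≡⟨ cong (λ m → + 1 + m - + s - + s + + 2) (ℤP.pos-* 2 k) ⟩
  + 1 + + 2 * + k - + s - + s + + 2         ≡⟨ regroup (+ k) (+ s) ⟩
  + 1 + (+ k - + s + + 1) * + 2             ∎)
  where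
  open ≡-Reasoning
  regroup : ∀ k s → + 1 + + 2 * k - s - s + + 2 ≡ + 1 + (k - s + + 1) * + 2
  regroup = solve-∀

oddOffset⇒odd : ∀ a s → Oddℤ (offset a s) → Odd a
oddOffset⇒odd a s (y , offset≡) with a ℕD.% 2 | ℕD.m%n<n a 2 | ℕD.m≡m%n+[m/n]*n a 2
... | 0 | _ | a≡ = ⊥-elim (odd≢even y (+ k - + s + + 1) (trans (sym offset≡) (begin
  + a - + s - + s + + 2                     ≡⟨ cong (λ n → + n - + s - + s + + 2) a≡ ⟩
  + (k ℕ.* 2) - + s - + s + + 2             ≡⟨ cong (λ m → m - + s - + s + + 2) (ℤP.pos-* k 2) ⟩
  + k * + 2 - + s - + s + + 2               ≡⟨ regroup (+ k) (+ s) ⟩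
  (+ k - + s + + 1) * + 2                   ∎)))
  where
  open ≡-Reasoning
  k : ℕ
  k = a ℕD./ 2
  regroup : ∀ k s → k * + 2 - s - s + + 2 ≡ (k - s + + 1) * + 2
  regroup = solve-∀
... | 1 | _ | a≡ = a ℕD./ 2 , trans a≡ (cong suc (ℕP.*-comm (a ℕD./ 2) 2))
... | suc (suc _) | s≤s (s≤s ()) | _

oddℤ-complement : ∀ α β → α + β ≡ + 4 → Oddℤ α → Oddℤ β
oddℤ-complement α β α+β≡4 (y , α≡) = + 1 - y , (begin
  β                         ≡⟨ isolate α β ⟩
  (α + β) - α               ≡⟨ cong₂ _-_ α+β≡4 α≡ ⟩
  + 4 - (+ 1 + y * + 2)     ≡⟨ reflect y ⟩
  + 1 + (+ 1 - y) * + 2     ∎)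
  where
  open ≡-Reasoning
  isolate : ∀ (α β : ℤ) → β ≡ (α + β) - α
  isolate = solve-∀
  reflect : ∀ y → + 4 - (+ 1 + y * + 2) ≡ + 1 + (+ 1 - y) * + 2
  reflect = solve-∀

offsets-sum⇔ : ∀ a b s t → offset a s + offset b t ≡ + 4 ⇔ 2 ℕ.* (s ℕ.+ t) ≡ a ℕ.+ b
offsets-sum⇔ a b s t = mk⇔ to from
  where
  open ≡-Reasoning
  excess : offset a s + offset b t - + 4 ≡ + (a ℕ.+ b) - + (2 ℕ.* (s ℕ.+ t))
  excess = begin
    offset a s + offset b t - + 4               ≡⟨ regroup (+ a) (+ b) (+ s) (+ t) ⟩
    (+ a + + b) - + 2 * (+ s + + t)             ≡⟨ cong₂ (λ u v → u - + 2 * v) (ℤP.pos-+ a b) (ℤP.pos-+ s t) ⟨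
    + (a ℕ.+ b) - + 2 * + (s ℕ.+ t)            ≡⟨ cong (λ v → + (a ℕ.+ b) - v) (ℤP.pos-* 2 (s ℕ.+ t)) ⟨
    + (a ℕ.+ b) - + (2 ℕ.* (s ℕ.+ t))          ∎
    where
    regroup : ∀ a b s t → a - s - s + + 2 + (b - t - t + + 2) - + 4 ≡ (a + b) - + 2 * (s + t)
    regroup = solve-∀
  to : offset a s + offset b t ≡ + 4 → 2 ℕ.* (s ℕ.+ t) ≡ a ℕ.+ b
  to sum≡4 = sym (ℤP.+-injective (ℤP.i-j≡0⇒i≡j _ _ (trans (sym excess) (ℤP.i≡j⇒i-j≡0 sum≡4))))
  from : 2 ℕ.* (s ℕ.+ t) ≡ a ℕ.+ b → offset a s + offset b t ≡ + 4
  from eq = ℤP.i-j≡0⇒i≡j _ _ (trans excess (ℤP.i≡j⇒i-j≡0 (cong +_ (sym eq))))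

≤-of-gap : ∀ x y k → y - x ≡ + k → x ≤ y
≤-of-gap x y k gap = ℤP.0≤i-j⇒j≤i (subst (0ℤ ≤_) (sym gap) (+≤+ z≤n))

≤-of-double-gap : ∀ x y k → (y - x) * + 2 ≡ + k → x ≤ y
≤-of-double-gap x y k gap = ℤP.0≤i-j⇒j≤i (nonnegative (y - x) gap)
  where
  nonnegative : ∀ d → d * + 2 ≡ + k → 0ℤ ≤ d
  nonnegative (+ _)    _  = +≤+ z≤n
  nonnegative -[1+ _ ] ()

+-difference-of-equals : ∀ w {u v : ℤ} → u ≡ v → w + (u - v) ≡ w
+-difference-of-equals w {u} refl = trans (cong (λ z → w + z) (ℤP.+-inverseʳ u)) (ℤP.+-identityʳ w)

branch-admissible : ∀ a s M → + (a ℕ.+ s ℕ.+ s ℕ.+ 3) ≤ M →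
  (+ 1 ≤ M - + a) × (+ 1 ≤ M - + s - ceilHalf (M - + a)) × (M - + s - ceilHalf (M - + a) < M)
branch-admissible a s M K≤M =
    ≤-of-gap (+ 1) (M - + a) _ first-gap
  , ≤-of-double-gap (+ 1) p _ lower-gap
  , ℤP.suc[i]≤j⇒i<j (≤-of-double-gap (+ 1 + p) M _ upper-gap)
  where
  open ≡-Reasoning
  K : ℕ
  K = a ℕ.+ s ℕ.+ s ℕ.+ 3
  j : ℕ
  j = ∣ M - + K ∣
  gap : M - + K ≡ + j
  gap = sym (ℤP.0≤i⇒+∣i∣≡i (ℤP.i≤j⇒0≤j-i K≤M))
  -- X = M − a + 1 = r + 2h where h = ⌈(M−a)/2⌉
  X h : ℤ
  X = M - + a + + 1
  h = X / + 2
  r : ℕ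
  r = X % + 2
  X≡ : X ≡ + r + h * + 2
  X≡ = a≡a%n+[a/n]*n X (+ 2)
  p : ℤ
  p = M - + s - h
  first-gap : M - + a - + 1 ≡ + j + + s + + s + + 2
  first-gap = trans (identity M (+ a) (+ s)) (cong (λ g → g + + s + + s + + 2) gap)
    where
    identity : ∀ M a s → M - a - + 1 ≡ M - (a + s + s + + 3) + s + s + + 2
    identity = solve-∀
  lower-gap : (p - + 1) * + 2 ≡ + j + + a + + a + + r
  lower-gap = begin
    (p - + 1) * + 2                                              ≡⟨ identity M (+ a) (+ s) h (+ r) ⟩
    (M - + K) + + a + + a + + r + (X - (+ r + h * + 2))          ≡⟨ +-difference-of-equals _ X≡ ⟩
    (M - + K) + + a + + a + + r                                  ≡⟨ cong (λ g → g + + a + + a + + r) gap ⟩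
    + j + + a + + a + + r                                        ∎
    where
    identity : ∀ M a s h r → (M - s - h - + 1) * + 2
                             ≡ (M - (a + s + s + + 3)) + a + a + r + ((M - a + + 1) - (r + h * + 2))
    identity = solve-∀
  upper-gap : (M - (+ 1 + p)) * + 2 ≡ + j + + s + + s + + s + + s + + (2 ℕ.∸ r)
  upper-gap = begin
    (M - (+ 1 + p)) * + 2                                                      ≡⟨ identity M (+ a) (+ s) h (+ r) ⟩
    (M - + K) + + s + + s + + s + + s + (+ 2 - + r) + ((+ r + h * + 2) - X)    ≡⟨ +-difference-of-equals _ (sym X≡) ⟩
    (M - + K) + + s + + s + + s + + s + (+ 2 - + r)                            ≡⟨ cong₂ (λ g e → g + + s + + s + + s + + s + e) gap two-minus-r ⟩
    + j + + s + + s + + s + + s + + (2 ℕ.∸ r)                                  ∎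
    where
    identity : ∀ M a s h r → (M - (+ 1 + (M - s - h))) * + 2
                             ≡ (M - (a + s + s + + 3)) + s + s + s + s + (+ 2 - r) + ((r + h * + 2) - (M - a + + 1))
    identity = solve-∀
    two-minus-r : + 2 - + r ≡ + (2 ℕ.∸ r)
    two-minus-r = trans (ℤP.m-n≡m⊖n 2 r) (ℤP.⊖-≥ (ℕP.<⇒≤ (n%d<d X (+ 2))))

minus-positive< : ∀ M a → 1 ℕ.≤ a → M - + a < M
minus-positive< M (suc a′) _ = ℤP.suc[i]≤j⇒i<j (≤-of-gap (+ 1 + (M - + suc a′)) M a′ (identity M (+ a′)))
  where
  identity : ∀ M a′ → M - (+ 1 + (M - (+ 1 + a′))) ≡ a′
  identity = solve-∀

-- Two solutions with the same initial conditions agree at every positive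
-- integer, by strong induction: every argument called for n > c lies in
-- {1, …, n−1}.
solutions-agree : ∀ {s t a b c R R′} → 1 ℕ.≤ a → 1 ℕ.≤ b →
  IsSolution s t a b c R → IsSolution s t a b c R′ → ∀ n → + 1 ≤ n → R n ≡ R′ n
solutions-agree {s} {t} {a} {b} {c} {R} {R′} 1≤a 1≤b (init , rec) (init′ , rec′) (+ m) =
  <-rec (λ m → + 1 ≤ + m → R (+ m) ≡ R′ (+ m)) step m
  where
  step : ∀ m → (∀ {k} → k ℕ.< m → + 1 ≤ + k → R (+ k) ≡ R′ (+ k)) → + 1 ≤ + m → R (+ m) ≡ R′ (+ m)
  step m IH 1≤m with m ℕ.≤? c
  ... | yes m≤c = trans (init (+ m) 1≤m (+≤+ m≤c)) (sym (init′ (+ m) 1≤m (+≤+ m≤c)))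
  ... | no m≰c with rec (+ m) (+<+ (ℕP.≰⇒> m≰c)) | rec′ (+ m) (+<+ (ℕP.≰⇒> m≰c))
  ...   | (1≤u , 1≤v , 1≤p , p<m , 1≤q , q<m , R≡) | (_ , _ , _ , _ , _ , _ , R′≡) =
    begin
      R (+ m)                                                                   ≡⟨ R≡ ⟩
      R (+ m - + s - R (+ m - + a)) + R (+ m - + t - R (+ m - + b))             ≡⟨ cong₂ _+_ (below _ 1≤p p<m) (below _ 1≤q q<m) ⟩
      R′ (+ m - + s - R (+ m - + a)) + R′ (+ m - + t - R (+ m - + b))           ≡⟨ cong₂ (λ x y → R′ (+ m - + s - x) + R′ (+ m - + t - y))
                                                                                      (below _ 1≤u (minus-positive< (+ m) a 1≤a))
                                                                                      (below _ 1≤v (minus-positive< (+ m) b 1≤b)) ⟩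
      R′ (+ m - + s - R′ (+ m - + a)) + R′ (+ m - + t - R′ (+ m - + b))         ≡⟨ R′≡ ⟨
      R′ (+ m)                                                                  ∎
    where
    open ≡-Reasoning
    below : ∀ x → + 1 ≤ x → x < + m → R x ≡ R′ x
    below (+ k)    1≤k (+<+ k<m) = IH k<m 1≤k
    below -[1+ _ ] () _

solution⇒offsets : ∀ s t a b c → IsSolution s t a b c ceilHalf →
  offset a s + offset b t ≡ + 4 × Oddℤ (offset a s)
solution⇒offsets s t a b c (_ , rec) =
  α+β≡4 , residue⇒oddℤ α (odd-residue c (α % + 4) (n%d<d α (+ 4)) reduced)
  where
  α β : ℤ
  α = offset a s
  β = offset b t
  agree : ∀ n → + c < n → ceilHalf n ≡ quarterPair α β n
  agree n c<n with rec n c<n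
  ... | (_ , _ , _ , _ , _ , _ , equation) = trans equation (ceilHalf-recursion n s t a b)
  α+β≡4 : α + β ≡ + 4
  α+β≡4 = offsets-sum α β (+ suc c) (λ n c+1≤n → agree n (ℤP.suc[i]≤j⇒i<j c+1≤n))
  reduced : ∀ n → + c < n → quarterPair (+ 1) (+ 3) n ≡ quarterPair (+ (α % + 4)) (+ 4 - + (α % + 4)) n
  reduced n c<n = trans (sym (ceilHalf-quarters n)) (trans (agree n c<n) (quarterPair-residue α β n α+β≡4))

threshold : ℕ → ℕ → ℕ → ℕ → ℕ
threshold s t a b = (a ℕ.+ s ℕ.+ s ℕ.+ 3) ℕ.+ (b ℕ.+ t ℕ.+ t ℕ.+ 3)

offsets⇒solution : ∀ s t a b → offset a s + offset b t ≡ + 4 → Oddℤ (offset a s) →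
  IsSolution s t a b (threshold s t a b) ceilHalf
offsets⇒solution s t a b α+β≡4 oddα = (λ _ _ _ → refl) , recursion
  where
  A B : ℕ
  A = a ℕ.+ s ℕ.+ s ℕ.+ 3
  B = b ℕ.+ t ℕ.+ t ℕ.+ 3
  α β : ℤ
  α = offset a s
  β = offset b t
  matches : ∀ n → ceilHalf n ≡ quarterPair α β n
  matches n = begin
    ceilHalf n                                            ≡⟨ ceilHalf-quarters n ⟩
    quarterPair (+ 1) (+ 3) n                             ≡⟨ quarterPair-odd-residue (α % + 4) n (oddℤ⇒residue α oddα) ⟩
    quarterPair (+ (α % + 4)) (+ 4 - + (α % + 4)) n        ≡⟨ quarterPair-residue α β n α+β≡4 ⟨
    quarterPair α β n                                     ∎
    where open ≡-Reasoning
  recursion : ∀ n → + (A ℕ.+ B) < n →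
    let p = n - + s - ceilHalf (n - + a)
        q = n - + t - ceilHalf (n - + b)
    in (+ 1 ≤ n - + a) × (+ 1 ≤ n - + b) × (+ 1 ≤ p) × (p < n) × (+ 1 ≤ q) × (q < n)
       × (ceilHalf n ≡ ceilHalf p + ceilHalf q)
  recursion n c<n =
    let (1≤u , 1≤p , p<n) = branch-admissible a s n (ℤP.≤-trans (+≤+ (ℕP.m≤m+n A B)) (ℤP.<⇒≤ c<n))
        (1≤v , 1≤q , q<n) = branch-admissible b t n (ℤP.≤-trans (+≤+ (ℕP.m≤n+m B A)) (ℤP.<⇒≤ c<n))
    in 1≤u , 1≤v , 1≤p , p<n , 1≤q , q<n , trans (matches n) (sym (ceilHalf-recursion n s t a b))

corollary3p5 : (s t a b : ℕ) → 1 ℕ.≤ a → 1 ℕ.≤ b →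
    (∃[ c ] CeilIsUniqueSolution s t a b c)
      ⇔ (Odd a × Odd b × 2 ℕ.* (s ℕ.+ t) ≡ a ℕ.+ b)
corollary3p5 s t a b 1≤a 1≤b = mk⇔ necessary sufficient
  where
  balance⇔ : offset a s + offset b t ≡ + 4 ⇔ 2 ℕ.* (s ℕ.+ t) ≡ a ℕ.+ b
  balance⇔ = offsets-sum⇔ a b s t
  necessary : ∃[ c ] CeilIsUniqueSolution s t a b c → Odd a × Odd b × 2 ℕ.* (s ℕ.+ t) ≡ a ℕ.+ b
  necessary (c , solution , _) =
    let (α+β≡4 , oddα) = solution⇒offsets s t a b c solution
    in  oddOffset⇒odd a s oddα
      , oddOffset⇒odd b t (oddℤ-complement (offset a s) (offset b t) α+β≡4 oddα)
      , Equivalence.to balance⇔ α+β≡4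
  sufficient : Odd a × Odd b × 2 ℕ.* (s ℕ.+ t) ≡ a ℕ.+ b → ∃[ c ] CeilIsUniqueSolution s t a b c
  -- oddness of b is implied by that of a together with the balance condition
  sufficient (odd-a , _ , balanced) =
    threshold s t a b , solution , λ R R-solution → solutions-agree 1≤a 1≤b R-solution solution
    where
    solution : IsSolution s t a b (threshold s t a b) ceilHalf
    solution = offsets⇒solution s t a b (Equivalence.from balance⇔ balanced) (odd⇒oddOffset a s odd-a)
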